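{- Let $k\ge2$ and $\zeta>0$. If $\Psi$ is a $k$-uniform constellation, then there exist at most $(k-2)\zeta|V(\Psi)|^k$ $k$-tuples $(x_1,\dots,x_k)\in V(\Psi)^k$ such that (a) $\{x_1,\dots,x_k\}\in E(\Psi)$, (b) $x_k\in V(R^\Psi_{\{x_1,\dots,x_{k-2}\}})$, and (c) $(x_2,\dots,x_k)$ fails to be $\zeta$-leftconnectable in $\Psi$.
   Context: A $k$-uniform hypergraph is $H=(V,E)$ with $E$ a set of $k$-element subsets of $V$. For $S\subseteq V$, $|S|\le k-2$, $\overline H_S$ is the hypergraph on $V\setminus S$ with edges $\{e\setminus S:S\subseteq e\in E\}$, and $H_S$ has the same edges on vertex set $V$. A $k$-uniform constellation ($k\ge 2$) is $\Psi=(H,\{R_x:x\in V(H)^{(k-2)}\})$ with $H$ $k$-uniform and each $R_x$ an induced subgraph of the graph $H_x$ (for $k=2$ only $R_\emptyset\subseteq H$); $V(\Psi)=V(H)$, $E(\Psi)=E(H)$, $R^\Psi_x=R_x$. For $|S|\le k-2$, the link constellation is $\Psi_S=(\overline H_S,\{R_{x\cup S}-S:x\in(V(H)\setminus S)^{(k-2-|S|)}\})$, $\Psi_z=\Psi_{\{z\}}$. Recursively, a $(k-1)$-tuple $(x_1,\dots,x_{k-1})$ of distinct vertices is $\zeta$-leftconnectable in $\Psi$ if for $k=2$: $x_1\in V(R_\emptyset)$; for $k\ge3$: at least $\zeta|V(\Psi)|$ vertices $z$ satisfy $\{x_1,\dots,x_{k-1},z\}\in E(\Psi)$ and $(x_2,\dots,x_{k-1})$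 is $\zeta$-leftconnectable in $\Psi_z$.
   Formalization: The parameter ζ ranges over the positive rationals. -}

module Defs where

open import Data.Nat using (ℕ; zero; suc; _∸_; _+_)
open import Data.Bool using (Bool; true; false; not; _∧_; if_then_else_)
open import Data.List using (List; []; _∷_; foldr; concatMap; map; take; drop)
open import Data.Fin using (Fin)
open import Data.Fin.Subset using (Subset; ⁅_⁆; _∪_; _-_; _⊆_; ∣_∣) renaming (⊥ to ∅)
open import Data.Vec using (lookup)
open import Data.List using () renaming (allFin to allFinL)
open import Data.Integer using (+_)
open import Data.Rational using (ℚ; _/_; _*_; _≤ᵇ_)
open import Data.Product using (_×_)
open import Relation.Binary.PropositionalEquality using (_≡_)

toℚ : ℕ → ℚ
toℚ n = + n / 1

-- Vertices are elements of an ambient Fin N; the vertex set V(Ψ) is a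
-- Subset N.
-- Since each R_x is an *induced* subgraph of H_x, it is determined by its
-- vertex set; R x is the vertex set V(R_x).
record Constellation (N : ℕ) : Set where
  field
    V : Subset N
    E : Subset N → Bool
    R : Subset N → Subset N
open Constellation public

-- Ψ is a k-uniform constellation: every edge is a k-subset of V, and for
-- every (k-2)-subset x of V, V(R_x) ⊆ V(H_x) = V.
IsConstellation : {N : ℕ} → ℕ → Constellation N → Set
IsConstellation k Ψ =
  (∀ e → E Ψ e ≡ true → (e ⊆ V Ψ) × (∣ e ∣ ≡ k))
  × (∀ x → x ⊆ V Ψ → ∣ x ∣ ≡ k ∸ 2 → R Ψ x ⊆ V Ψ)

link : {N : ℕ} → Constellation N → Fin N → Constellation N
link Ψ z = record
  { V = V Ψ - z
  ; E = λ e → not (lookup e z) ∧ E Ψ (e ∪ ⁅ z ⁆)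
  ; R = λ x → R Ψ (x ∪ ⁅ z ⁆) - z
  }

setOf : {N : ℕ} → List (Fin N) → Subset N
setOf = foldr (λ x s → ⁅ x ⁆ ∪ s) ∅

allIn : {N : ℕ} → Subset N → List (Fin N) → Bool
allIn s = foldr (λ x b → lookup s x ∧ b) true

countIn : {N : ℕ} → Subset N → (Fin N → Bool) → ℕ
countIn {N} S P = foldr (λ z c → if lookup S z ∧ P z then suc c else c) 0 (allFinL N)

-- ζ-leftconnectability of the tuple (x₁,…,x_{k-1}) in Ψ (recursive on k):
--  k = 2 : x₁ ∈ V(R_∅);
--  k ≥ 3 : #{z ∈ V(Ψ) : {x₁,…,x_{k-1},z} ∈ E(Ψ) and (x₂,…,x_{k-1})
--          is ζ-leftconnectable in Ψ_z}  ≥  ζ |V(Ψ)|.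
-- (The empty tuple never occurs for k ≥ 2; it is declared not connectable.)
LeftConn : {N : ℕ} → ℚ → Constellation N → List (Fin N) → Bool
LeftConn ζ Ψ [] = false
LeftConn ζ Ψ (x ∷ []) = lookup (R Ψ ∅) x
LeftConn ζ Ψ (x ∷ y ∷ ys) =
  (ζ * toℚ ∣ V Ψ ∣) ≤ᵇ toℚ (countIn (V Ψ) (λ z →
     E Ψ (setOf (x ∷ y ∷ ys) ∪ ⁅ z ⁆) ∧ LeftConn ζ (link Ψ z) (y ∷ ys)))

tuples : (N k : ℕ) → List (List (Fin N))
tuples N zero = [] ∷ []
tuples N (suc k) = concatMap (λ x → map (x ∷_) (tuples N k)) (allFinL N)

Bad : {N : ℕ} → ℕ → ℚ → Constellation N → List (Fin N) → Bool
Bad k ζ Ψ xs =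
  allIn (V Ψ) xs
  ∧ E Ψ (setOf xs)
  ∧ allIn (R Ψ (setOf (take (k ∸ 2) xs))) (drop (k ∸ 1) xs)  -- (b) x_k ∈ V(R_{x₁..x_{k-2}})
  ∧ not (LeftConn ζ Ψ (drop 1 xs))

countBad : {N : ℕ} → ℕ → ℚ → Constellation N → ℕ
countBad {N} k ζ Ψ = foldr (λ xs c → if Bad k ζ Ψ xs then suc c else c) 0 (tuples N k)

-- Write n = |V(Ψ)| and k = 2 + m.  For
-- k = 2 no tuple is bad: condition (b) says x₂ ∈ V(R_∅), which is exactly the
-- leftconnectability of (x₂) that (c) denies.  For k = 3 + m, split a bad
-- tuple (x, T), T = (x₂,…,x_k), according to whether the tail (x₃,…,x_k) is
-- ζ-leftconnectable in the link Ψ_x: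
--   * if it is, x is one of the extensions of T counted in the definition of
--     leftconnectability; T fails that test, so each T has at most ζn such x,
--     giving at most ζ n^k tuples;
--   * if it is not, T is a bad (k-1)-tuple of Ψ_x (x does not occur in T since
--     edges are k-sets), so by induction there are at most (k-3) ζ n^(k-1)
--     such T for each of the n vertices x.
-- Adding up gives (k-2) ζ n^k.

module Submission where

open import Defs
open import Data.Nat using (ℕ; _≤_; _∸_; _^_)
open import Data.Rational using (ℚ; 0ℚ; _<_; _*_) renaming (_≤_ to _≤ℚ_)
open import Data.Fin.Subset using (∣_∣)

open import Data.Nat as ℕ using (zero; suc; _+_; z≤n; s≤s)
import Data.Nat.Properties as ℕP
open import Algebra.Properties.CommutativeSemigroup ℕP.+-commutativeSemigroup
  using () renaming (interchange to +-interchange)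
open import Data.Nat.Coprimality using (1-coprimeTo) renaming (sym to coprime-sym)
import Data.Integer as ℤ
import Data.Integer.Properties as ℤP
open import Data.Rational as ℚ using (mkℚ; 1ℚ; _≤ᵇ_; *≤*) renaming (_+_ to _+ℚ_)
import Data.Rational.Properties as ℚP
open import Data.Rational.Solver using (module +-*-Solver)
open import Data.Bool using (Bool; true; false; _∧_; _∨_; not; if_then_else_; T)
open import Data.List using (List; []; _∷_; _++_; foldr; map; concatMap; length; take; drop; tabulate; allFin)
open import Data.List.Relation.Unary.All as All using (All; []; _∷_)
import Data.List.Relation.Unary.All.Properties as AllP
open import Data.Fin using (Fin) renaming (zero to fzero; suc to fsuc)
open import Data.Fin.Subset using (Subset; ⁅_⁆; _∪_; _─_; _-_) renaming (⊥ to ∅)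
open import Data.Fin.Subset.Properties using (∪-comm; ∪-identityˡ; ∣⊥∣≡0; ∣p∣≤∣x∷p∣; ∣p─q∣≤∣p∣)
open import Data.Vec using (lookup) renaming ([] to []ᵛ; _∷_ to _∷ᵛ_)
open import Data.Vec.Properties using (lookup-zipWith; lookup-replicate)
open import Data.Product using (_×_; _,_; proj₁; proj₂)
open import Data.Unit using (⊤)
open import Data.Empty using (⊥-elim)
open import Relation.Binary.PropositionalEquality using (_≡_; refl; sym; trans; cong; cong₂; subst; subst₂; module ≡-Reasoning)

-- The embedding n ↦ n/1 of ℕ into ℚ preserves +, · and ≤; the proofs use
-- that toℚ n is already in lowest terms.
toℚ-normal : ∀ n → toℚ n ≡ mkℚ (ℤ.+ n) 0 (coprime-sym (1-coprimeTo n))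
toℚ-normal n = ℚP.normalize-coprime (coprime-sym (1-coprimeTo n))

toℚ-+ : ∀ a b → toℚ (a + b) ≡ toℚ a +ℚ toℚ b
toℚ-+ a b rewrite toℚ-normal a | toℚ-normal b =
  cong (ℚ._/ 1) (sym (cong₂ ℤ._+_ (ℤP.*-identityʳ (ℤ.+ a)) (ℤP.*-identityʳ (ℤ.+ b))))

toℚ-* : ∀ a b → toℚ (a ℕ.* b) ≡ toℚ a * toℚ b
toℚ-* a b rewrite toℚ-normal a | toℚ-normal b = cong (ℚ._/ 1) (ℤP.pos-* a b)

toℚ-mono : ∀ {a b} → a ≤ b → toℚ a ≤ℚ toℚ b
toℚ-mono {a} {b} a≤b rewrite toℚ-normal a | toℚ-normal b =
  *≤* (subst₂ ℤ._≤_ (sym (ℤP.*-identityʳ (ℤ.+ a))) (sym (ℤP.*-identityʳ (ℤ.+ b))) (ℤ.+≤+ a≤b))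

toℚ-nonNeg : ∀ n → 0ℚ ≤ℚ toℚ n
toℚ-nonNeg n = toℚ-mono {0} {n} z≤n

0≤* : ∀ {p q} → 0ℚ ≤ℚ p → 0ℚ ≤ℚ q → 0ℚ ≤ℚ p * q
0≤* {p} {q} 0≤p 0≤q =
  ℚP.nonNegative⁻¹ (p * q) {{ℚP.nonNeg*nonNeg⇒nonNeg p {{ℚ.nonNegative 0≤p}} q {{ℚ.nonNegative 0≤q}}}}

≤ᵇ-false : ∀ p q → (p ≤ᵇ q) ≡ false → q ≤ℚ p
≤ᵇ-false p q p≰ᵇq = ℚP.<⇒≤ (ℚP.≰⇒> (λ p≤q → subst T p≰ᵇq (ℚP.≤⇒≤ᵇ p≤q)))

ind : Bool → ℕ
ind b = if b then 1 else 0

∧-true : ∀ {a b} → a ∧ b ≡ true → a ≡ true × b ≡ true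
∧-true {true} {true} refl = refl , refl

not-true : ∀ {a} → not a ≡ true → a ≡ false
not-true {false} refl = refl

∨-false : ∀ {a b} → a ∨ b ≡ false → a ≡ false × b ≡ false
∨-false {false} {false} refl = refl , refl

ind-≤ : ∀ a {c} → (a ≡ true → 1 ≤ c) → ind a ≤ c
ind-≤ false _ = z≤n
ind-≤ true 1≤c = 1≤c refl

guard-bound : ∀ d a c {q} → 0ℚ ≤ℚ q → (d ≡ true → a ≡ true × toℚ c ≤ℚ q) →
  toℚ (ind d ℕ.* c) ≤ℚ toℚ (ind a) * q
guard-bound false a c 0≤q _ = 0≤* (toℚ-nonNeg (ind a)) 0≤q
guard-bound true a c {q} 0≤q forced with forced refl
... | refl , c≤q = subst₂ _≤ℚ_ (cong toℚ (sym (ℕP.+-identityʳ c))) (sym (ℚP.*-identityˡ q)) c≤q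

private
  variable
    A B : Set

∑ : List A → (A → ℕ) → ℕ
∑ xs f = foldr (λ x s → f x + s) 0 xs

syntax ∑ xs (λ x → e) = ∑[ x ∈ xs ] e

count≡∑ : (P : A → Bool) (xs : List A) →
  foldr (λ x c → if P x then suc c else c) 0 xs ≡ ∑[ x ∈ xs ] ind (P x)
count≡∑ P [] = refl
count≡∑ P (x ∷ xs) with P x
... | true = cong suc (count≡∑ P xs)
... | false = count≡∑ P xs

∑-cong : ∀ {f g : A → ℕ} xs → (∀ x → f x ≡ g x) → ∑ xs f ≡ ∑ xs g
∑-cong [] _ = refl
∑-cong (x ∷ xs) f≡g = cong₂ _+_ (f≡g x) (∑-cong xs f≡g)

∑-mono : ∀ {f g : A → ℕ} {xs} → All (λ x → f x ≤ g x) xs → ∑ xs f ≤ ∑ xs g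
∑-mono [] = z≤n
∑-mono (fx≤gx ∷ rest) = ℕP.+-mono-≤ fx≤gx (∑-mono rest)

∑-zero : ∀ (xs : List A) → ∑[ x ∈ xs ] 0 ≡ 0
∑-zero [] = refl
∑-zero (_ ∷ xs) = ∑-zero xs

∑-++ : ∀ (f : A → ℕ) xs ys → ∑ (xs ++ ys) f ≡ ∑ xs f + ∑ ys f
∑-++ f [] ys = refl
∑-++ f (x ∷ xs) ys = trans (cong (f x +_) (∑-++ f xs ys)) (sym (ℕP.+-assoc (f x) _ _))

∑-map : ∀ (f : B → ℕ) (g : A → B) xs → ∑ (map g xs) f ≡ ∑[ x ∈ xs ] f (g x)
∑-map f g [] = refl
∑-map f g (x ∷ xs) = cong (f (g x) +_) (∑-map f g xs)

∑-+ : ∀ (f g : A → ℕ) xs → ∑[ x ∈ xs ] (f x + g x) ≡ ∑ xs f + ∑ xs g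
∑-+ f g [] = refl
∑-+ f g (x ∷ xs) = begin
  f x + g x + ∑[ y ∈ xs ] (f y + g y) ≡⟨ cong (f x + g x +_) (∑-+ f g xs) ⟩
  f x + g x + (∑ xs f + ∑ xs g)       ≡⟨ +-interchange (f x) (g x) (∑ xs f) (∑ xs g) ⟩
  f x + ∑ xs f + (g x + ∑ xs g)       ∎
  where open ≡-Reasoning

∑-*ʳ : ∀ (f : A → ℕ) c xs → ∑[ x ∈ xs ] (f x ℕ.* c) ≡ ∑ xs f ℕ.* c
∑-*ʳ f c [] = refl
∑-*ʳ f c (x ∷ xs) = trans (cong (f x ℕ.* c +_) (∑-*ʳ f c xs)) (sym (ℕP.*-distribʳ-+ c (f x) _))

∑-∧ : ∀ a (P : A → Bool) xs → ∑[ x ∈ xs ] ind (a ∧ P x) ≡ ind a ℕ.* ∑[ x ∈ xs ] ind (P x)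
∑-∧ true P xs = sym (ℕP.+-identityʳ _)
∑-∧ false P xs = ∑-zero xs

∑-swap : ∀ (f : A → B → ℕ) xs (ys : List B) →
  ∑[ x ∈ xs ] ∑[ y ∈ ys ] f x y ≡ ∑[ y ∈ ys ] ∑[ x ∈ xs ] f x y
∑-swap f [] ys = sym (∑-zero ys)
∑-swap f (x ∷ xs) ys =
  trans (cong (∑ ys (f x) +_) (∑-swap f xs ys)) (sym (∑-+ (f x) (λ y → ∑[ x′ ∈ xs ] f x′ y) ys))

∑-bound : ∀ (f g : A → ℕ) q {xs} → All (λ x → toℚ (f x) ≤ℚ toℚ (g x) * q) xs →
  toℚ (∑ xs f) ≤ℚ toℚ (∑ xs g) * q
∑-bound f g q [] = ℚP.≤-reflexive (sym (ℚP.*-zeroˡ q))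
∑-bound f g q {x ∷ xs} (fx≤ ∷ rest) = begin
  toℚ (f x + ∑ xs f)                   ≡⟨ toℚ-+ (f x) _ ⟩
  toℚ (f x) +ℚ toℚ (∑ xs f)            ≤⟨ ℚP.+-mono-≤ fx≤ (∑-bound f g q rest) ⟩
  toℚ (g x) * q +ℚ toℚ (∑ xs g) * q    ≡⟨ sym (ℚP.*-distribʳ-+ q (toℚ (g x)) _) ⟩
  (toℚ (g x) +ℚ toℚ (∑ xs g)) * q      ≡⟨ cong (_* q) (sym (toℚ-+ (g x) _)) ⟩
  toℚ (g x + ∑ xs g) * q               ∎
  where open ℚP.≤-Reasoning

∑-tabulate : ∀ {n} (g : Fin n → A) (f : A → ℕ) →
  ∑ (tabulate g) f ≡ ∑[ i ∈ allFin n ] f (g i)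
∑-tabulate {n = zero} g f = refl
∑-tabulate {n = suc n} g f =
  cong (f (g fzero) +_) (trans (∑-tabulate (λ i → g (fsuc i)) f) (sym (∑-tabulate fsuc (λ i → f (g i)))))

∣∣≡∑ : ∀ {n} (S : Subset n) → ∣ S ∣ ≡ ∑[ i ∈ allFin n ] ind (lookup S i)
∣∣≡∑ []ᵛ = refl
∣∣≡∑ (true ∷ᵛ S) = cong suc (trans (∣∣≡∑ S) (sym (∑-tabulate fsuc (λ i → ind (lookup (true ∷ᵛ S) i)))))
∣∣≡∑ (false ∷ᵛ S) = trans (∣∣≡∑ S) (sym (∑-tabulate fsuc (λ i → ind (lookup (false ∷ᵛ S) i))))

∑-tuples-suc : ∀ N j (f : List (Fin N) → ℕ) →
  ∑ (tuples N (suc j)) f ≡ ∑[ x ∈ allFin N ] ∑[ T ∈ tuples N j ] f (x ∷ T)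
∑-tuples-suc N j f = split (allFin N)
  where
  split : ∀ xs → ∑ (concatMap (λ x → map (x ∷_) (tuples N j)) xs) f ≡ ∑[ x ∈ xs ] ∑[ T ∈ tuples N j ] f (x ∷ T)
  split [] = refl
  split (x ∷ xs) = trans (∑-++ f (map (x ∷_) (tuples N j)) _) (cong₂ _+_ (∑-map f (x ∷_) (tuples N j)) (split xs))

tuples-length : ∀ N j → All (λ T → length T ≡ j) (tuples N j)
tuples-length N zero = refl ∷ []
tuples-length N (suc j) = AllP.concat⁺ (AllP.map⁺ (All.universal
  (λ x → AllP.map⁺ (All.map (cong suc) (tuples-length N j))) (allFin N)))

∑-tuples-in : ∀ {N} (S : Subset N) j → ∑[ T ∈ tuples N j ] ind (allIn S T) ≡ ∣ S ∣ ^ j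
∑-tuples-in {N} S zero = refl
∑-tuples-in {N} S (suc j) = begin
  ∑[ T ∈ tuples N (suc j) ] ind (allIn S T)                      ≡⟨ ∑-tuples-suc N j _ ⟩
  ∑[ x ∈ allFin N ] ∑[ T ∈ tuples N j ] ind (lookup S x ∧ allIn S T)
    ≡⟨ ∑-cong (allFin N) (λ x → trans (∑-∧ (lookup S x) (allIn S) (tuples N j))
                                      (cong (ind (lookup S x) ℕ.*_) (∑-tuples-in S j))) ⟩
  ∑[ x ∈ allFin N ] (ind (lookup S x) ℕ.* ∣ S ∣ ^ j)              ≡⟨ ∑-*ʳ _ (∣ S ∣ ^ j) (allFin N) ⟩
  ∑[ x ∈ allFin N ] ind (lookup S x) ℕ.* ∣ S ∣ ^ j                ≡⟨ cong (ℕ._* ∣ S ∣ ^ j) (sym (∣∣≡∑ S)) ⟩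
  ∣ S ∣ ℕ.* ∣ S ∣ ^ j                                            ∎
  where open ≡-Reasoning

lookup-∪ : ∀ {n} (p q : Subset n) i → lookup (p ∪ q) i ≡ lookup p i ∨ lookup q i
lookup-∪ p q i = lookup-zipWith _∨_ i p q

lookup-─ : ∀ {n} (p q : Subset n) i → lookup q i ≡ false → lookup (p ─ q) i ≡ lookup p i
lookup-─ (a ∷ᵛ p) (false ∷ᵛ q) fzero refl = refl
lookup-─ (a ∷ᵛ p) (b ∷ᵛ q) (fsuc i) i∉q = lookup-─ p q i i∉q

⁅⁆-sym : ∀ {n} (x y : Fin n) → lookup ⁅ x ⁆ y ≡ lookup ⁅ y ⁆ x
⁅⁆-sym fzero fzero = refl
⁅⁆-sym fzero (fsuc y) = lookup-replicate y false
⁅⁆-sym (fsuc x) fzero = sym (lookup-replicate x false)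
⁅⁆-sym (fsuc x) (fsuc y) = ⁅⁆-sym x y

⁅⁆∪-absorb : ∀ {n} (x : Fin n) (p : Subset n) → lookup p x ≡ true → ⁅ x ⁆ ∪ p ≡ p
⁅⁆∪-absorb fzero (true ∷ᵛ p) refl = cong (true ∷ᵛ_) (∪-identityˡ p)
⁅⁆∪-absorb (fsuc x) (b ∷ᵛ p) x∈p = cong (b ∷ᵛ_) (⁅⁆∪-absorb x p x∈p)

∣⁅⁆∪∣≤ : ∀ {n} (x : Fin n) (p : Subset n) → ∣ ⁅ x ⁆ ∪ p ∣ ≤ suc ∣ p ∣
∣⁅⁆∪∣≤ fzero (b ∷ᵛ p) rewrite ∪-identityˡ p = s≤s (∣p∣≤∣x∷p∣ b p)
∣⁅⁆∪∣≤ (fsuc x) (true ∷ᵛ p) = s≤s (∣⁅⁆∪∣≤ x p)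
∣⁅⁆∪∣≤ (fsuc x) (false ∷ᵛ p) = ∣⁅⁆∪∣≤ x p

-- x does not occur in the list L.  Edges of a k-uniform constellation are
-- spanned only by repetition-free lists, which is what makes links usable.
Fresh : {N : ℕ} → Fin N → List (Fin N) → Set
Fresh x L = lookup (setOf L) x ≡ false

fresh-∷ : ∀ {N} (x y : Fin N) L → Fresh x (y ∷ L) → lookup ⁅ x ⁆ y ≡ false × Fresh x L
fresh-∷ x y L fresh with ∨-false (trans (sym (lookup-∪ ⁅ y ⁆ (setOf L) x)) fresh)
... | x∉⁅y⁆ , x∉L = trans (⁅⁆-sym x y) x∉⁅y⁆ , x∉L

fresh-drop : ∀ {N} (x : Fin N) j L → Fresh x L → Fresh x (drop j L)
fresh-drop x zero L fresh = fresh
fresh-drop x (suc j) [] fresh = fresh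
fresh-drop x (suc j) (y ∷ L) fresh = fresh-drop x j L (proj₂ (fresh-∷ x y L fresh))

allIn-fresh : ∀ {N} (S : Subset N) x L → Fresh x L → allIn (S - x) L ≡ allIn S L
allIn-fresh S x [] _ = refl
allIn-fresh S x (y ∷ L) fresh with fresh-∷ x y L fresh
... | y∉⁅x⁆ , x∉L = cong₂ _∧_ (lookup-─ S ⁅ x ⁆ y y∉⁅x⁆) (allIn-fresh S x L x∉L)

Distinct : {N : ℕ} → List (Fin N) → Set
Distinct [] = ⊤
Distinct (x ∷ L) = Fresh x L × Distinct L

∣setOf∣≤length : ∀ {N} (L : List (Fin N)) → ∣ setOf L ∣ ≤ length L
∣setOf∣≤length {N} [] = ℕP.≤-reflexive (∣⊥∣≡0 N)
∣setOf∣≤length (x ∷ L) = ℕP.≤-trans (∣⁅⁆∪∣≤ x (setOf L)) (s≤s (∣setOf∣≤length L))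

distinct-by-size : ∀ {N} (L : List (Fin N)) → ∣ setOf L ∣ ≡ length L → Distinct L
distinct-by-size [] _ = _
distinct-by-size (x ∷ L) size with lookup (setOf L) x in x∈L?
... | true = ⊥-elim (ℕP.<-irrefl refl (begin-strict
      length L                  <⟨ ℕP.n<1+n _ ⟩
      suc (length L)            ≡⟨ sym size ⟩
      ∣ ⁅ x ⁆ ∪ setOf L ∣       ≡⟨ cong ∣_∣ (⁅⁆∪-absorb x (setOf L) x∈L?) ⟩
      ∣ setOf L ∣               ≤⟨ ∣setOf∣≤length L ⟩
      length L                  ∎))
  where open ℕP.≤-Reasoning
... | false = refl , distinct-by-size L (ℕP.≤-antisym (∣setOf∣≤length L)
                (ℕP.≤-pred (begin
                  suc (length L)         ≡⟨ sym size ⟩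
                  ∣ ⁅ x ⁆ ∪ setOf L ∣    ≤⟨ ∣⁅⁆∪∣≤ x (setOf L) ⟩
                  suc ∣ setOf L ∣        ∎)))
  where open ℕP.≤-Reasoning

EdgesDistinct : {N : ℕ} → ℕ → Constellation N → Set
EdgesDistinct k Ψ = ∀ L → length L ≡ k → E Ψ (setOf L) ≡ true → Distinct L

edgesDistinct : ∀ {N k} {Ψ : Constellation N} → IsConstellation k Ψ → EdgesDistinct k Ψ
edgesDistinct (uniform , _) L len edge =
  distinct-by-size L (trans (proj₂ (uniform (setOf L) edge)) (sym len))

edgesDistinct-link : ∀ {N k} {Ψ : Constellation N} z → EdgesDistinct (suc k) Ψ → EdgesDistinct k (link Ψ z)
edgesDistinct-link {Ψ = Ψ} z dist L len edge = proj₂ (dist (z ∷ L) (cong suc len)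
  (subst (λ e → E Ψ e ≡ true) (∪-comm (setOf L) ⁅ z ⁆) (proj₂ (∧-true edge))))

bad-edge : ∀ {N} k ζ (Ψ : Constellation N) xs → Bad k ζ Ψ xs ≡ true → E Ψ (setOf xs) ≡ true
bad-edge k ζ Ψ xs bad = proj₁ (∧-true (proj₂ (∧-true {allIn (V Ψ) xs} bad)))

-- For k = 2 there are no bad tuples: (b) says x₂ ∈ V(R_∅) and (c) denies it.
no-bad-pair : ∀ {N} ζ (Ψ : Constellation N) xs → length xs ≡ 2 → ind (Bad 2 ζ Ψ xs) ≤ 0
no-bad-pair ζ Ψ (x ∷ y ∷ []) refl =
  ℕP.≤-reflexive (cong ind (contradictory (allIn (V Ψ) (x ∷ y ∷ [])) (E Ψ (setOf (x ∷ y ∷ []))) (lookup (R Ψ ∅) y)))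
  where
  contradictory : ∀ a e c → a ∧ e ∧ (c ∧ true) ∧ not c ≡ false
  contradictory false e c = refl
  contradictory true false c = refl
  contradictory true true true = refl
  contradictory true true false = refl

no-bad-pairs : ∀ {N} ζ (Ψ : Constellation N) → countBad 2 ζ Ψ ≡ 0
no-bad-pairs {N} ζ Ψ = ℕP.n≤0⇒n≡0 (begin
  countBad 2 ζ Ψ                           ≡⟨ count≡∑ (Bad 2 ζ Ψ) (tuples N 2) ⟩
  ∑[ xs ∈ tuples N 2 ] ind (Bad 2 ζ Ψ xs)  ≤⟨ ∑-mono (All.map (λ {xs} → no-bad-pair ζ Ψ xs) (tuples-length N 2)) ⟩
  ∑[ xs ∈ tuples N 2 ] 0                   ≡⟨ ∑-zero (tuples N 2) ⟩
  0                                        ∎)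
  where open ℕP.≤-Reasoning

-- The tuple x ∷ T, k = 3 + m, in terms of T and x (orienting unions as in links).
bad-cons : ∀ {N} m ζ (Ψ : Constellation N) x T →
  Bad (3 + m) ζ Ψ (x ∷ T) ≡
    (lookup (V Ψ) x ∧ allIn (V Ψ) T) ∧ E Ψ (setOf T ∪ ⁅ x ⁆)
    ∧ allIn (R Ψ (setOf (take m T) ∪ ⁅ x ⁆)) (drop (suc m) T) ∧ not (LeftConn ζ Ψ T)
bad-cons m ζ Ψ x T =
  cong₂ (λ e r → (lookup (V Ψ) x ∧ allIn (V Ψ) T) ∧ E Ψ e ∧ allIn (R Ψ r) (drop (suc m) T) ∧ not (LeftConn ζ Ψ T))
        (∪-comm ⁅ x ⁆ (setOf T)) (∪-comm ⁅ x ⁆ (setOf (take m T)))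

bad-link : ∀ {N} m ζ (Ψ : Constellation N) x T → Fresh x T →
  Bad (2 + m) ζ (link Ψ x) T ≡
    allIn (V Ψ) T ∧ E Ψ (setOf T ∪ ⁅ x ⁆)
    ∧ allIn (R Ψ (setOf (take m T) ∪ ⁅ x ⁆)) (drop (suc m) T) ∧ not (LeftConn ζ (link Ψ x) (drop 1 T))
bad-link m ζ Ψ x T fresh = begin
  Bad (2 + m) ζ (link Ψ x) T
    ≡⟨ cong₂ (λ v r → v ∧ (not (lookup (setOf T) x) ∧ edge) ∧ r ∧ tail)
             (allIn-fresh (V Ψ) x T fresh)
             (allIn-fresh Rx x (drop (suc m) T) (fresh-drop x (suc m) T fresh)) ⟩
  allIn (V Ψ) T ∧ (not (lookup (setOf T) x) ∧ edge) ∧ allIn Rx (drop (suc m) T) ∧ tail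
    ≡⟨ cong (λ b → allIn (V Ψ) T ∧ (not b ∧ edge) ∧ allIn Rx (drop (suc m) T) ∧ tail) fresh ⟩
  allIn (V Ψ) T ∧ edge ∧ allIn Rx (drop (suc m) T) ∧ tail ∎
  where
  open ≡-Reasoning
  edge = E Ψ (setOf T ∪ ⁅ x ⁆)
  Rx = R Ψ (setOf (take m T) ∪ ⁅ x ⁆)
  tail = not (LeftConn ζ (link Ψ x) (drop 1 T))

-- The Boolean core of the case split: a bad x ∷ T either has its tail
-- connectable in the link (l′ = true) or is bad in the link (l′ = false).
case-split : ∀ v w e r l l′ → (v ∧ w) ∧ e ∧ r ∧ not l ≡ true →
  1 ≤ ind ((w ∧ not l) ∧ v ∧ e ∧ l′) + ind (v ∧ w ∧ e ∧ r ∧ not l′)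
case-split true true true true false true refl = s≤s z≤n
case-split true true true true false false refl = s≤s z≤n
case-split false _ _ _ _ _ ()
case-split true false _ _ _ _ ()
case-split true true false _ _ _ ()
case-split true true true false _ _ ()
case-split true true true true true _ ()

bound-arithmetic : ∀ n j m ζ →
  toℚ (n ^ j) * (ζ * toℚ n) +ℚ toℚ n * (toℚ (n ^ j) * (toℚ m * ζ)) ≡ (toℚ (suc m) * ζ) * toℚ (n ^ suc j)
bound-arithmetic n j m ζ = begin
  X * (ζ * toℚ n) +ℚ toℚ n * (X * (toℚ m * ζ))  ≡⟨ ring X ζ (toℚ n) (toℚ m) ⟩
  ((1ℚ +ℚ toℚ m) * ζ) * (toℚ n * X)             ≡⟨ cong₂ (λ a b → (a * ζ) * b) (sym (toℚ-+ 1 m)) (sym (toℚ-* n (n ^ j))) ⟩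
  (toℚ (suc m) * ζ) * toℚ (n ^ suc j)          ∎
  where
  open ≡-Reasoning
  open +-*-Solver using (solve; _:*_; _:+_; _:=_; con)
  X = toℚ (n ^ j)
  ring : ∀ x z a b → x * (z * a) +ℚ a * (x * (b * z)) ≡ ((1ℚ +ℚ b) * z) * (a * x)
  ring = solve 4 (λ x z a b → x :* (z :* a) :+ a :* (x :* (b :* z)) := ((con 1ℚ :+ b) :* z) :* (a :* x)) refl

module BadTuples (ζ : ℚ) (0≤ζ : 0ℚ ≤ℚ ζ) where

  Bound : ℕ → Set
  Bound m = ∀ {N} (Ψ : Constellation N) → EdgesDistinct (2 + m) Ψ →
    toℚ (countBad (2 + m) ζ Ψ) ≤ℚ (toℚ m * ζ) * toℚ (∣ V Ψ ∣ ^ (2 + m))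

  base : Bound 0
  base Ψ _ = begin
    toℚ (countBad 2 ζ Ψ)               ≡⟨ cong toℚ (no-bad-pairs ζ Ψ) ⟩
    0ℚ                                 ≡⟨ sym (ℚP.*-zeroˡ (toℚ (∣ V Ψ ∣ ^ 2))) ⟩
    0ℚ * toℚ (∣ V Ψ ∣ ^ 2)             ≡⟨ cong (_* toℚ (∣ V Ψ ∣ ^ 2)) (sym (ℚP.*-zeroˡ ζ)) ⟩
    (toℚ 0 * ζ) * toℚ (∣ V Ψ ∣ ^ 2)    ∎
    where open ℚP.≤-Reasoning

  module Step (m : ℕ) {N : ℕ} (Ψ : Constellation N) (dist : EdgesDistinct (3 + m) Ψ) where

    n : ℕ
    n = ∣ V Ψ ∣

    Ts : List (List (Fin N))
    Ts = tuples N (2 + m)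

    Unconnectable : List (Fin N) → Bool
    Unconnectable T = allIn (V Ψ) T ∧ not (LeftConn ζ Ψ T)

    Extension : List (Fin N) → Fin N → Bool
    Extension T x = lookup (V Ψ) x ∧ (E Ψ (setOf T ∪ ⁅ x ⁆) ∧ LeftConn ζ (link Ψ x) (drop 1 T))

    LinkConnected : Fin N → List (Fin N) → Bool
    LinkConnected x T = Unconnectable T ∧ Extension T x

    LinkBad : Fin N → List (Fin N) → Bool
    LinkBad x T = lookup (V Ψ) x ∧ Bad (2 + m) ζ (link Ψ x) T

    -- Every bad tuple x ∷ T falls into one of the two cases; x does not occur
    -- in T because x ∷ T spans an edge.
    bad-cases : ∀ x T → length T ≡ 2 + m →
      ind (Bad (3 + m) ζ Ψ (x ∷ T)) ≤ ind (LinkConnected x T) + ind (LinkBad x T)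
    bad-cases x T len = ind-≤ (Bad (3 + m) ζ Ψ (x ∷ T)) λ bad →
      subst (λ b → 1 ≤ ind (LinkConnected x T) + ind (lookup (V Ψ) x ∧ b))
        (sym (bad-link m ζ Ψ x T (x∉T bad)))
        (case-split (lookup (V Ψ) x) (allIn (V Ψ) T) (E Ψ (setOf T ∪ ⁅ x ⁆))
                    (allIn (R Ψ (setOf (take m T) ∪ ⁅ x ⁆)) (drop (suc m) T))
                    (LeftConn ζ Ψ T) (LeftConn ζ (link Ψ x) (drop 1 T))
                    (trans (sym (bad-cons m ζ Ψ x T)) bad))
      where
      x∉T : Bad (3 + m) ζ Ψ (x ∷ T) ≡ true → Fresh x T
      x∉T bad = proj₁ (dist (x ∷ T) (cong suc len) (bad-edge (3 + m) ζ Ψ (x ∷ T) bad))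

    countBad-split : countBad (3 + m) ζ Ψ ≤
        ∑[ T ∈ Ts ] ∑[ x ∈ allFin N ] ind (LinkConnected x T)
      + ∑[ x ∈ allFin N ] ∑[ T ∈ Ts ] ind (LinkBad x T)
    countBad-split = begin
      countBad (3 + m) ζ Ψ
        ≡⟨ count≡∑ (Bad (3 + m) ζ Ψ) (tuples N (3 + m)) ⟩
      ∑[ xs ∈ tuples N (3 + m) ] ind (Bad (3 + m) ζ Ψ xs)
        ≡⟨ ∑-tuples-suc N (2 + m) (λ xs → ind (Bad (3 + m) ζ Ψ xs)) ⟩
      ∑[ x ∈ allFin N ] ∑[ T ∈ Ts ] ind (Bad (3 + m) ζ Ψ (x ∷ T))
        ≤⟨ ∑-mono (All.universal (λ x → ∑-mono (All.map (λ {T} → bad-cases x T) (tuples-length N (2 + m)))) (allFin N)) ⟩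
      ∑[ x ∈ allFin N ] ∑[ T ∈ Ts ] (ind (LinkConnected x T) + ind (LinkBad x T))
        ≡⟨ ∑-cong (allFin N) (λ x → ∑-+ (λ T → ind (LinkConnected x T)) (λ T → ind (LinkBad x T)) Ts) ⟩
      ∑[ x ∈ allFin N ] (∑[ T ∈ Ts ] ind (LinkConnected x T) + ∑[ T ∈ Ts ] ind (LinkBad x T))
        ≡⟨ ∑-+ _ _ (allFin N) ⟩
      ∑[ x ∈ allFin N ] ∑[ T ∈ Ts ] ind (LinkConnected x T) + ∑[ x ∈ allFin N ] ∑[ T ∈ Ts ] ind (LinkBad x T)
        ≡⟨ cong (_+ ∑[ x ∈ allFin N ] ∑[ T ∈ Ts ] ind (LinkBad x T)) (∑-swap (λ x T → ind (LinkConnected x T)) (allFin N) Ts) ⟩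
      ∑[ T ∈ Ts ] ∑[ x ∈ allFin N ] ind (LinkConnected x T) + ∑[ x ∈ allFin N ] ∑[ T ∈ Ts ] ind (LinkBad x T)
        ∎
      where open ℕP.≤-Reasoning

    -- Since T fails the leftconnectability test, it has at most ζn extensions.
    linkConnected-per-tuple : ∀ T → length T ≡ 2 + m →
      toℚ (∑[ x ∈ allFin N ] ind (LinkConnected x T)) ≤ℚ toℚ (ind (allIn (V Ψ) T)) * (ζ * toℚ n)
    linkConnected-per-tuple T@(_ ∷ _ ∷ _) _ = begin
      toℚ (∑[ x ∈ allFin N ] ind (LinkConnected x T))
        ≡⟨ cong toℚ (∑-∧ (Unconnectable T) (Extension T) (allFin N)) ⟩
      toℚ (ind (Unconnectable T) ℕ.* ∑[ x ∈ allFin N ] ind (Extension T x))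
        ≡⟨ cong (λ c → toℚ (ind (Unconnectable T) ℕ.* c)) (sym (count≡∑ (Extension T) (allFin N))) ⟩
      toℚ (ind (Unconnectable T) ℕ.* countIn (V Ψ) _)
        ≤⟨ guard-bound (Unconnectable T) (allIn (V Ψ) T) _ (0≤* 0≤ζ (toℚ-nonNeg n)) few-extensions ⟩
      toℚ (ind (allIn (V Ψ) T)) * (ζ * toℚ n) ∎
      where
      open ℚP.≤-Reasoning
      few-extensions : Unconnectable T ≡ true →
        allIn (V Ψ) T ≡ true × toℚ (countIn (V Ψ) (λ x → E Ψ (setOf T ∪ ⁅ x ⁆) ∧ LeftConn ζ (link Ψ x) (drop 1 T))) ≤ℚ ζ * toℚ n
      few-extensions unconnectable with ∧-true {allIn (V Ψ) T} unconnectable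
      ... | inV , notConn = inV , ≤ᵇ-false _ _ (not-true notConn)

    linkConnected-bound :
      toℚ (∑[ T ∈ Ts ] ∑[ x ∈ allFin N ] ind (LinkConnected x T)) ≤ℚ toℚ (n ^ (2 + m)) * (ζ * toℚ n)
    linkConnected-bound =
      subst (λ c → toℚ (∑[ T ∈ Ts ] ∑[ x ∈ allFin N ] ind (LinkConnected x T)) ≤ℚ toℚ c * (ζ * toℚ n))
        (∑-tuples-in (V Ψ) (2 + m))
      (∑-bound (λ T → ∑[ x ∈ allFin N ] ind (LinkConnected x T)) (λ T → ind (allIn (V Ψ) T)) (ζ * toℚ n)
        (All.map (λ {T} → linkConnected-per-tuple T) (tuples-length N (2 + m))))

    module _ (IH : Bound m) where

      linkBad-per-vertex : ∀ x →
        toℚ (∑[ T ∈ Ts ] ind (LinkBad x T)) ≤ℚ toℚ (ind (lookup (V Ψ) x)) * (toℚ (n ^ (2 + m)) * (toℚ m * ζ))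
      linkBad-per-vertex x = begin
        toℚ (∑[ T ∈ Ts ] ind (LinkBad x T))
          ≡⟨ cong toℚ (∑-∧ (lookup (V Ψ) x) (Bad (2 + m) ζ (link Ψ x)) Ts) ⟩
        toℚ (ind (lookup (V Ψ) x) ℕ.* ∑[ T ∈ Ts ] ind (Bad (2 + m) ζ (link Ψ x) T))
          ≡⟨ cong (λ c → toℚ (ind (lookup (V Ψ) x) ℕ.* c)) (sym (count≡∑ (Bad (2 + m) ζ (link Ψ x)) Ts)) ⟩
        toℚ (ind (lookup (V Ψ) x) ℕ.* countBad (2 + m) ζ (link Ψ x))
          ≤⟨ guard-bound (lookup (V Ψ) x) (lookup (V Ψ) x) (countBad (2 + m) ζ (link Ψ x)) (0≤* (toℚ-nonNeg (n ^ (2 + m))) mζ≥0) (λ x∈V → x∈V , link-bound) ⟩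
        toℚ (ind (lookup (V Ψ) x)) * (toℚ (n ^ (2 + m)) * (toℚ m * ζ)) ∎
        where
        open ℚP.≤-Reasoning
        mζ≥0 : 0ℚ ≤ℚ toℚ m * ζ
        mζ≥0 = 0≤* (toℚ-nonNeg m) 0≤ζ
        link-bound : toℚ (countBad (2 + m) ζ (link Ψ x)) ≤ℚ toℚ (n ^ (2 + m)) * (toℚ m * ζ)
        link-bound = begin
          toℚ (countBad (2 + m) ζ (link Ψ x))      ≤⟨ IH (link Ψ x) (edgesDistinct-link {Ψ = Ψ} x dist) ⟩
          (toℚ m * ζ) * toℚ (∣ V Ψ - x ∣ ^ (2 + m)) ≤⟨ ℚP.*-monoˡ-≤-nonNeg (toℚ m * ζ) {{ℚ.nonNegative mζ≥0}}
                                                        (toℚ-mono (ℕP.^-monoˡ-≤ (2 + m) (∣p─q∣≤∣p∣ (V Ψ) ⁅ x ⁆))) ⟩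
          (toℚ m * ζ) * toℚ (n ^ (2 + m))          ≡⟨ ℚP.*-comm (toℚ m * ζ) (toℚ (n ^ (2 + m))) ⟩
          toℚ (n ^ (2 + m)) * (toℚ m * ζ)          ∎

      linkBad-bound :
        toℚ (∑[ x ∈ allFin N ] ∑[ T ∈ Ts ] ind (LinkBad x T)) ≤ℚ toℚ n * (toℚ (n ^ (2 + m)) * (toℚ m * ζ))
      linkBad-bound =
        subst (λ c → toℚ (∑[ x ∈ allFin N ] ∑[ T ∈ Ts ] ind (LinkBad x T)) ≤ℚ toℚ c * (toℚ (n ^ (2 + m)) * (toℚ m * ζ)))
          (sym (∣∣≡∑ (V Ψ)))
        (∑-bound (λ x → ∑[ T ∈ Ts ] ind (LinkBad x T)) (λ x → ind (lookup (V Ψ) x)) (toℚ (n ^ (2 + m)) * (toℚ m * ζ)) (All.universal linkBad-per-vertex (allFin N)))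

      bound : toℚ (countBad (3 + m) ζ Ψ) ≤ℚ (toℚ (suc m) * ζ) * toℚ (n ^ (3 + m))
      bound = begin
        toℚ (countBad (3 + m) ζ Ψ)   ≤⟨ toℚ-mono countBad-split ⟩
        toℚ (connected + bad)        ≡⟨ toℚ-+ connected bad ⟩
        toℚ connected +ℚ toℚ bad     ≤⟨ ℚP.+-mono-≤ linkConnected-bound linkBad-bound ⟩
        toℚ (n ^ (2 + m)) * (ζ * toℚ n) +ℚ toℚ n * (toℚ (n ^ (2 + m)) * (toℚ m * ζ))
                                     ≡⟨ bound-arithmetic n (2 + m) m ζ ⟩
        (toℚ (suc m) * ζ) * toℚ (n ^ (3 + m)) ∎
        where
        open ℚP.≤-Reasoning
        connected bad : ℕ
        connected = ∑[ T ∈ Ts ] ∑[ x ∈ allFin N ] ind (LinkConnected x T)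
        bad = ∑[ x ∈ allFin N ] ∑[ T ∈ Ts ] ind (LinkBad x T)

  countBad-bound : ∀ m → Bound m
  countBad-bound zero = base
  countBad-bound (suc m) Ψ dist = Step.bound m Ψ dist (countBad-bound m)

lemma2p19 : {N : ℕ} (k : ℕ) (ζ : ℚ) (Ψ : Constellation N)
    → 2 ≤ k → 0ℚ < ζ → IsConstellation k Ψ
    → toℚ (countBad k ζ Ψ) ≤ℚ (toℚ (k ∸ 2) * ζ) * toℚ (∣ V Ψ ∣ ^ k)
lemma2p19 (suc (suc m)) ζ Ψ (s≤s (s≤s z≤n)) 0<ζ isConstellation =
  BadTuples.countBad-bound ζ (ℚP.<⇒≤ 0<ζ) m Ψ (edgesDistinct isConstellation)
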